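{- Let $T=(t_1,t_2,\ldots)$ be a finite or infinite tournament sequence and let $M=\phi(T)=(m_1,m_2,\ldots)$ be the associated Meeussen sequence. Write $ur(M)=\{u_1<u_2<u_3<\cdots\}$. Then for every index $i$ of the sequence: (1) $u_{t_i}=m_i-1$, and (2) $u_{t_i+1}=m_1+m_2+\cdots+m_{i-1}+1$.
   Context: A tournament sequence is an increasing sequence of positive integers with $t_1=1$ and $t_i<t_{i+1}\leq 2t_i$. For an integer sequence $A$, $r(A)$ is the set of subset sums (by index, including the empty sum $0$) of its terms and $ur(A)$ the set of integers that are such a sum for exactly one set of indices. An infinite Meeussen sequence is a sequence of positive integers $(m_1,m_2,\ldots)$ with $m_1=1$, $m_i<m_{i+1}$, all nonnegative integers in $r(M)$ and each $m_i-1\in ur(M)$; a finite one is an initial segment of an infinite one. Both kinds of sequences form rooted trees (root $(1)$, parent of $(s_1,\ldots,s_n)$ is $(s_1,\ldots,s_{n-1})$, infinite sequences being infinite paths), and $\phi$ denotes the unique rooted-tree isomorphism from tournament sequences to Meeussen sequences (it preserves length). -}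

module Defs where

open import Data.Nat using (ℕ; zero; suc; _+_; _*_; _∸_; _<_; _≤_)
open import Data.Bool using (Bool; true; false)
open import Data.Fin using (Fin; toℕ; inject₁)
import Data.Fin as F
open import Data.Vec using (Vec; []; _∷_; lookup; head; toList)
open import Data.List using (List; map; length)
open import Data.Nat.ListAction using (sum)
open import Data.List.Relation.Unary.Linked using (Linked)
open import Data.List.Membership.Propositional using (_∈_)
open import Data.Product using (Σ; _×_; ∃)
open import Function.Bundles using (_⇔_)
open import Relation.Binary.PropositionalEquality using (_≡_)

-- Finite sequences are vectors; subsets of indices are Vec Bool n
-- (true = index selected).

subsetSum : ∀ {n} → Vec Bool n → Vec ℕ n → ℕ
subsetSum []           []       = 0
subsetSum (true  ∷ s)  (a ∷ as) = a + subsetSum s as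
subsetSum (false ∷ s)  (a ∷ as) = subsetSum s as

InR : ∀ {n} → Vec ℕ n → ℕ → Set
InR {n} A x = Σ (Vec Bool n) λ s → subsetSum s A ≡ x

InUR : ∀ {n} → Vec ℕ n → ℕ → Set
InUR {n} A x = Σ (Vec Bool n) λ s →
  subsetSum s A ≡ x × (∀ (s' : Vec Bool n) → subsetSum s' A ≡ x → s' ≡ s)

-- Infinite sequences are functions ℕ → ℕ (index 0 = first term);
-- finite index sets are strictly increasing lists of indices.

InRInf : (ℕ → ℕ) → ℕ → Set
InRInf A x = Σ (List ℕ) λ is → Linked _<_ is × sum (map A is) ≡ x

InURInf : (ℕ → ℕ) → ℕ → Set
InURInf A x = Σ (List ℕ) λ is → Linked _<_ is × sum (map A is) ≡ x ×
  (∀ (js : List ℕ) → Linked _<_ js → sum (map A js) ≡ x → js ≡ is)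

-- IsKth P k v : writing {x | P x} = {u₁ < u₂ < ...}, we have u_k = v
-- (1-indexed): v ∈ P and exactly k-1 elements of P are below v.

IsKth : (ℕ → Set) → ℕ → ℕ → Set
IsKth P k v = P v × Σ (List ℕ) λ xs → Linked _<_ xs × suc (length xs) ≡ k ×
  (∀ x → (x ∈ xs) ⇔ (P x × x < v))

IsTournament : ∀ {n} → Vec ℕ (suc n) → Set
IsTournament {n} t = head t ≡ 1 ×
  (∀ (i : Fin n) → lookup t (inject₁ i) < lookup t (F.suc i)
                 × lookup t (F.suc i) ≤ 2 * lookup t (inject₁ i))

IsTournamentInf : (ℕ → ℕ) → Set
IsTournamentInf t = t 0 ≡ 1 × (∀ i → t i < t (suc i) × t (suc i) ≤ 2 * t i)

IsMeeussenInf : (ℕ → ℕ) → Set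
IsMeeussenInf m = m 0 ≡ 1 × (∀ i → m i < m (suc i)) ×
  (∀ (v : ℕ) → InRInf m v) × (∀ i → InURInf m (m i ∸ 1))

IsMeeussen : ∀ {n} → Vec ℕ (suc n) → Set
IsMeeussen {n} v = Σ (ℕ → ℕ) λ m → IsMeeussenInf m ×
  (∀ (i : Fin (suc n)) → lookup v i ≡ m (toℕ i))

-- Rooted-tree isomorphism from the tournament tree to the Meeussen tree
-- (nodes = finite sequences, root (1), parent = drop last term).
-- Given as a length-preserving map on sequences which restricts to a
-- bijection between the node sets and commutes with taking parents.

Seqmap : Set
Seqmap = ∀ {n} → Vec ℕ (suc n) → Vec ℕ (suc n)

record IsTreeIso (φ : Seqmap) : Set where
  field
    maps   : ∀ {n} (t : Vec ℕ (suc n)) → IsTournament t → IsMeeussen (φ t)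
    inj    : ∀ {n} (s t : Vec ℕ (suc n)) → IsTournament s → IsTournament t →
             φ s ≡ φ t → s ≡ t
    surj   : ∀ {n} (m : Vec ℕ (suc n)) → IsMeeussen m →
             Σ (Vec ℕ (suc n)) λ t → IsTournament t × φ t ≡ m
    parent : ∀ {n} (t : Vec ℕ (suc (suc n))) → IsTournament t →
             φ (Data.Vec.init t) ≡ Data.Vec.init (φ t)
    root   : φ (1 ∷ []) ≡ 1 ∷ []

prefix : (n : ℕ) → (ℕ → ℕ) → Vec ℕ n
prefix n a = Data.Vec.tabulate (λ i → a (toℕ i))

sumFirst : ∀ {n} → ℕ → Vec ℕ n → ℕ
sumFirst k v = sum (Data.List.take k (toList v))

{-# OPTIONS --safe #-}
-- Let M = φ t with last term m and sum S, and let a be the last term of t. Along every branch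
-- of the tournament tree, every number up to S is a subset sum of M, the unique sums avoid
-- [m, S ∸ m] and are symmetric under z ↦ S ∸ z, and exactly a of them lie below m; so M has
-- 2a unique sums in [0, S]. The children of t end in a < x ≤ 2a and are sent to M ∷ʳ y with
-- y ∸ 1 a unique sum of M, so g x = #(ur M below y) is injective and bounded by 2a. The x
-- children of t ∷ʳ x give, reflected, x distinct unique sums of M below y, so x ≤ g x. An
-- inflationary injection of (a, 2a] into itself is the identity: exactly x unique sums lie
-- below y, which is (1) and the invariant for the child. Reflecting m ∸ 1 gives
-- S ∸ m + 1 = m₁ + ⋯ + m_{i-1} + 1, the first unique sum after the gap, which is (2).
-- Infinite sequences reduce to prefixes, as sums below m_{i+1} only involve m₁, …, mᵢ.
module Submission where

open import Defs
open import Data.Nat using (ℕ; zero; suc; _+_; _∸_; _*_; _≤_; _<_; z≤n; s≤s; _≟_; _≤?_)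
open import Data.Nat.Properties
open import Algebra.Properties.CommutativeSemigroup +-commutativeSemigroup using (x∙yz≈y∙xz)
open import Data.Bool using (true; false)
import Data.Bool.Properties as Bool
open import Data.Fin using (Fin; toℕ; inject₁; fromℕ; fromℕ<)
import Data.Fin as Fin
import Data.Fin.Properties as Fin
open import Data.Fin.Subset using (Subset; ∁)
open import Data.Fin.Subset.Properties using (anySubset?)
open import Data.Vec as Vec using (Vec; []; _∷_; _∷ʳ_; lookup; last; head)
import Data.Vec.Properties as Vec
open import Data.List as List using (List; map; upTo; filter; length)
import Data.List.Properties as List
open import Data.List.Membership.Propositional.Properties using (∈-filter⁺; ∈-filter⁻; ∈-upTo⁺; ∈-upTo⁻)
open import Data.List.Relation.Unary.Linked as Linked using (Linked)
import Data.List.Relation.Unary.Linked.Properties as Linked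
open import Data.Nat.ListAction using (sum)
open import Data.List.Relation.Unary.All as All using (All)
import Data.List.Relation.Unary.AllPairs as AllPairs
open import Data.Product using (Σ; _×_; _,_; proj₁; proj₂)
open import Data.Sum using (inj₁; inj₂)
open import Function using (_∘_)
open import Function.Bundles using (mk⇔; Equivalence)
open import Data.Empty using (⊥)
open import Relation.Nullary using (¬_; Dec; yes; no; contradiction)
open import Relation.Nullary.Decidable using (map′; ¬?; _×-dec_; _→-dec_; decidable-stable)
open import Relation.Unary using (Decidable)
open import Relation.Binary.Definitions using (tri<; tri≈; tri>)
open import Relation.Binary.PropositionalEquality
  using (_≡_; refl; sym; trans; cong; cong₂; subst; subst₂; module ≡-Reasoning)

subsetSum-∷ʳ-false : ∀ {n} (s : Subset n) (v : Vec ℕ n) a → subsetSum (s ∷ʳ false) (v ∷ʳ a) ≡ subsetSum s v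
subsetSum-∷ʳ-false []          []      a = refl
subsetSum-∷ʳ-false (true ∷ s)  (x ∷ v) a = cong (x +_) (subsetSum-∷ʳ-false s v a)
subsetSum-∷ʳ-false (false ∷ s) (x ∷ v) a = subsetSum-∷ʳ-false s v a

subsetSum-∷ʳ-true : ∀ {n} (s : Subset n) (v : Vec ℕ n) a → subsetSum (s ∷ʳ true) (v ∷ʳ a) ≡ subsetSum s v + a
subsetSum-∷ʳ-true []          []      a = +-identityʳ a
subsetSum-∷ʳ-true (true ∷ s)  (x ∷ v) a = trans (cong (x +_) (subsetSum-∷ʳ-true s v a)) (sym (+-assoc x _ a))
subsetSum-∷ʳ-true (false ∷ s) (x ∷ v) a = subsetSum-∷ʳ-true s v a

sum-∷ʳ : ∀ {n} (v : Vec ℕ n) a → Vec.sum (v ∷ʳ a) ≡ Vec.sum v + a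
sum-∷ʳ []      a = +-identityʳ a
sum-∷ʳ (x ∷ v) a = trans (cong (x +_) (sum-∷ʳ v a)) (sym (+-assoc x _ a))

subsetSum≤sum : ∀ {n} (s : Subset n) (v : Vec ℕ n) → subsetSum s v ≤ Vec.sum v
subsetSum≤sum []          []      = z≤n
subsetSum≤sum (true ∷ s)  (x ∷ v) = +-monoʳ-≤ x (subsetSum≤sum s v)
subsetSum≤sum (false ∷ s) (x ∷ v) = ≤-trans (subsetSum≤sum s v) (m≤n+m _ x)

subsetSum+subsetSum-∁ : ∀ {n} (s : Subset n) (v : Vec ℕ n) → subsetSum s v + subsetSum (∁ s) v ≡ Vec.sum v
subsetSum+subsetSum-∁ []          []      = refl
subsetSum+subsetSum-∁ (true ∷ s)  (x ∷ v) = trans (+-assoc x _ _) (cong (x +_) (subsetSum+subsetSum-∁ s v))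
subsetSum+subsetSum-∁ (false ∷ s) (x ∷ v) =
  trans (x∙yz≈y∙xz (subsetSum s v) x _) (cong (x +_) (subsetSum+subsetSum-∁ s v))

subsetSum-∁ : ∀ {n} (s : Subset n) (v : Vec ℕ n) → subsetSum (∁ s) v ≡ Vec.sum v ∸ subsetSum s v
subsetSum-∁ s v = trans (sym (m+n∸m≡n (subsetSum s v) _)) (cong (_∸ subsetSum s v) (subsetSum+subsetSum-∁ s v))

∁-involutive : ∀ {n} (s : Subset n) → ∁ (∁ s) ≡ s
∁-involutive s = trans (sym (Vec.map-∘ _ _ s)) (trans (Vec.map-cong Bool.not-involutive s) (Vec.map-id s))

InUR-reflect : ∀ {n} (v : Vec ℕ n) z → InUR v z → InUR v (Vec.sum v ∸ z)
InUR-reflect v z (s , s≡z , unique) = ∁ s , trans (subsetSum-∁ s v) (cong (Vec.sum v ∸_) s≡z) , unique∁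
  where
  z≤sum : z ≤ Vec.sum v
  z≤sum = subst (_≤ Vec.sum v) s≡z (subsetSum≤sum s v)
  unique∁ : ∀ s′ → subsetSum s′ v ≡ Vec.sum v ∸ z → s′ ≡ ∁ s
  unique∁ s′ s′≡ = trans (sym (∁-involutive s′)) (cong ∁ (unique (∁ s′)
    (trans (subsetSum-∁ s′ v) (trans (cong (Vec.sum v ∸_) s′≡) (m∸[m∸n]≡n z≤sum)))))

avoids-last : ∀ {n} (v : Vec ℕ n) {a x} (s′ : Subset (suc n)) → x < a → subsetSum s′ (v ∷ʳ a) ≡ x →
              Σ (Subset n) λ s → s′ ≡ s ∷ʳ false × subsetSum s v ≡ x
avoids-last v {a} s′ x<a s′≡x with Vec.initLast s′
... | s , true  , refl =
  contradiction (subst (a ≤_) (trans (sym (subsetSum-∷ʳ-true s v a)) s′≡x) (m≤n+m a _)) (<⇒≱ x<a)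
... | s , false , refl = s , refl , trans (sym (subsetSum-∷ʳ-false s v a)) s′≡x

InUR-∷ʳ⁻ : ∀ {n} (v : Vec ℕ n) {a x} → x < a → InUR (v ∷ʳ a) x → InUR v x
InUR-∷ʳ⁻ v {a} x<a (s′ , s′≡x , unique) with avoids-last v s′ x<a s′≡x
... | s , refl , s≡x = s , s≡x ,
  λ s″ s″≡x → Vec.∷ʳ-injectiveˡ s″ s (unique (s″ ∷ʳ false) (trans (subsetSum-∷ʳ-false s″ v a) s″≡x))

InUR-∷ʳ⁺ : ∀ {n} (v : Vec ℕ n) {a x} → x < a → InUR v x → InUR (v ∷ʳ a) x
InUR-∷ʳ⁺ v {a} {x} x<a (s , s≡x , unique) = s ∷ʳ false , trans (subsetSum-∷ʳ-false s v a) s≡x , unique′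
  where
  unique′ : ∀ s′ → subsetSum s′ (v ∷ʳ a) ≡ x → s′ ≡ s ∷ʳ false
  unique′ s′ s′≡x with avoids-last v s′ x<a s′≡x
  ... | s″ , refl , s″≡x = cong (_∷ʳ false) (unique s″ s″≡x)

Complete : ∀ {n} → Vec ℕ n → Set
Complete v = ∀ x → x ≤ Vec.sum v → InR v x

Complete-∷ʳ : ∀ {n} (v : Vec ℕ n) {a} → Complete v → a ≤ suc (Vec.sum v) → Complete (v ∷ʳ a)
Complete-∷ʳ {n} v {a} complete a≤ x x≤ with x ≤? Vec.sum v
... | yes x≤sum = let (s , s≡x) = complete x x≤sum in s ∷ʳ false , trans (subsetSum-∷ʳ-false s v a) s≡x
... | no  x≰sum = s ∷ʳ true , trans (subsetSum-∷ʳ-true s v a) (trans (cong (_+ a) s≡x∸a) (m∸n+n≡m a≤x))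
  where
  a≤x : a ≤ x
  a≤x = ≤-trans a≤ (≰⇒> x≰sum)
  x∸a≤sum : x ∸ a ≤ Vec.sum v
  x∸a≤sum = subst (x ∸ a ≤_) (m+n∸n≡m (Vec.sum v) a) (∸-monoˡ-≤ a (subst (x ≤_) (sum-∷ʳ v a) x≤))
  s : Subset n
  s = proj₁ (complete (x ∸ a) x∸a≤sum)
  s≡x∸a : subsetSum s v ≡ x ∸ a
  s≡x∸a = proj₂ (complete (x ∸ a) x∸a≤sum)

-- Such a z has a representation avoiding the new term a and, through z ∸ a, one using it.
InUR-∷ʳ-gap : ∀ {n} (v : Vec ℕ n) {a z} → Complete v → InUR (v ∷ʳ a) z → a ≤ z → z ≤ Vec.sum v → ⊥
InUR-∷ʳ-gap {n} v {a} {z} complete (s , _ , unique) a≤z z≤sum =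
  contradiction (Vec.∷ʳ-injectiveʳ s₁ s₂ (trans avoiding-a (sym using-a))) λ ()
  where
  z∸a≤sum : z ∸ a ≤ Vec.sum v
  z∸a≤sum = ≤-trans (m∸n≤m z a) z≤sum
  s₁ s₂ : Subset n
  s₁ = proj₁ (complete z z≤sum)
  s₂ = proj₁ (complete (z ∸ a) z∸a≤sum)
  avoiding-a : s₁ ∷ʳ false ≡ s
  avoiding-a = unique _ (trans (subsetSum-∷ʳ-false s₁ v a) (proj₂ (complete z z≤sum)))
  using-a : s₂ ∷ʳ true ≡ s
  using-a = unique _ (trans (subsetSum-∷ʳ-true s₂ v a)
    (trans (cong (_+ a) (proj₂ (complete (z ∸ a) z∸a≤sum))) (m∸n+n≡m a≤z)))

allSubset? : ∀ {n} {P : Subset n → Set} → Decidable P → Dec (∀ s → P s)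
allSubset? P? = map′ (λ ¬∃¬P s → decidable-stable (P? s) (λ ¬Ps → ¬∃¬P (s , ¬Ps)))
                     (λ ∀P (s , ¬Ps) → ¬Ps (∀P s))
                     (¬? (anySubset? (¬? ∘ P?)))

InUR? : ∀ {n} (v : Vec ℕ n) → Decidable (InUR v)
InUR? v x = anySubset? λ s → (subsetSum s v ≟ x) ×-dec
  allSubset? λ s′ → (subsetSum s′ v ≟ x) →-dec Vec.≡-dec Bool._≟_ s′ s

module Counting {P : ℕ → Set} (P? : Decidable P) where

  below : ℕ → List ℕ
  below v = filter P? (upTo v)

  #below : ℕ → ℕ
  #below v = length (below v)

  #below-suc : ∀ v → #below (suc v) ≡ #below v + length (filter P? (v List.∷ List.[]))
  #below-suc v = trans (cong (length ∘ filter P?) (sym (List.upTo-∷ʳ v)))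
    (trans (cong length (List.filter-++ P? (upTo v) _)) (List.length-++ (below v)))

  #below-suc-yes : ∀ {v} → P v → #below (suc v) ≡ suc (#below v)
  #below-suc-yes {v} Pv = trans (#below-suc v)
    (trans (cong (λ xs → #below v + length xs) (List.filter-accept P? Pv)) (+-comm (#below v) 1))

  #below-suc-no : ∀ {v} → ¬ P v → #below (suc v) ≡ #below v
  #below-suc-no {v} ¬Pv = trans (#below-suc v)
    (trans (cong (λ xs → #below v + length xs) (List.filter-reject P? ¬Pv)) (+-identityʳ (#below v)))

  IsKth-#below : ∀ {v} → P v → IsKth P (suc (#below v)) v
  IsKth-#below {v} Pv = Pv , below v , Linked.filter⁺ P? <-trans (Linked.applyUpTo⁺₂ _ v n<1+n) , refl ,
    λ x → mk⇔ (λ x∈ → let (x∈upTo , Px) = ∈-filter⁻ P? x∈ in Px , ∈-upTo⁻ x∈upTo)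
              (λ (Px , x<v) → ∈-filter⁺ P? (∈-upTo⁺ x<v) Px)

  #below-≤-suc : ∀ v → #below v ≤ #below (suc v)
  #below-≤-suc v = subst (#below v ≤_) (sym (#below-suc v)) (m≤m+n (#below v) _)

  #below-mono : ∀ {a b} → a ≤ b → #below a ≤ #below b
  #below-mono {b = zero}  z≤n = ≤-refl
  #below-mono {b = suc b} a≤1+b with m≤n⇒m<n∨m≡n a≤1+b
  ... | inj₁ a<1+b = ≤-trans (#below-mono (≤-pred a<1+b)) (#below-≤-suc b)
  ... | inj₂ refl  = ≤-refl

  #below-strict : ∀ {a b} → P a → a < b → #below a < #below b
  #below-strict Pa a<b = subst (_≤ _) (#below-suc-yes Pa) (#below-mono a<b)

  #below-injective : ∀ {a b} → P a → P b → #below a ≡ #below b → a ≡ b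
  #below-injective {a} {b} Pa Pb eq with <-cmp a b
  ... | tri< a<b _ _ = contradiction eq (<⇒≢ (#below-strict Pa a<b))
  ... | tri≈ _ a≡b _ = a≡b
  ... | tri> _ _ b<a = contradiction (sym eq) (<⇒≢ (#below-strict Pb b<a))

  #below-gap : ∀ {a b} → a ≤ b → (∀ x → a ≤ x → x < b → ¬ P x) → #below b ≡ #below a
  #below-gap {a} {zero}  z≤n     _    = refl
  #below-gap {a} {suc b} a≤1+b   none with m≤n⇒m<n∨m≡n a≤1+b
  ... | inj₁ a<1+b = trans (#below-suc-no (none b (≤-pred a<1+b) ≤-refl))
                           (#below-gap (≤-pred a<1+b) λ x a≤x x<b → none x a≤x (m<n⇒m<1+n x<b))
  ... | inj₂ refl  = refl

  #below-exchange : ∀ {x y} → (P x → P y) → (P y → P x) → #below (suc x) + #below y ≡ #below x + #below (suc y)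
  #below-exchange {x} {y} x⇒y y⇒x with P? x
  ... | yes Px = trans (cong (_+ #below y) (#below-suc-yes Px))
                       (trans (sym (+-suc (#below x) (#below y))) (cong (#below x +_) (sym (#below-suc-yes (x⇒y Px)))))
  ... | no ¬Px = trans (cong (_+ #below y) (#below-suc-no ¬Px))
                       (cong (#below x +_) (sym (#below-suc-no (¬Px ∘ y⇒x))))

  #below-reflect : ∀ S → (∀ z → z ≤ S → P z → P (S ∸ z)) →
                   ∀ b → b ≤ suc S → #below (suc S) ≡ #below (suc S ∸ b) + #below b
  #below-reflect S reflect zero    _       = sym (+-identityʳ _)
  #below-reflect S reflect (suc b) 1+b≤1+S = begin
    #below (suc S)                     ≡⟨ #below-reflect S reflect b (≤-trans (n≤1+n b) 1+b≤1+S) ⟩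
    #below (suc S ∸ b) + #below b      ≡⟨ cong (λ w → #below w + #below b) (+-∸-assoc 1 b≤S) ⟩
    #below (suc (S ∸ b)) + #below b    ≡⟨ #below-exchange reflect-S∸b (reflect b b≤S) ⟩
    #below (S ∸ b) + #below (suc b)    ∎
    where
    open ≡-Reasoning
    b≤S : b ≤ S
    b≤S = ≤-pred 1+b≤1+S
    reflect-S∸b : P (S ∸ b) → P b
    reflect-S∸b = subst P (m∸[m∸n]≡n b≤S) ∘ reflect (S ∸ b) (m∸n≤m S b)

  ≤-#below : ∀ {k v} (f : Fin k → ℕ) → (∀ {i j} → f i ≡ f j → i ≡ j) →
             (∀ j → P (f j)) → (∀ j → f j < v) → k ≤ #below v
  ≤-#below {k} {v} f f-injective Pf f<v = Fin.injective⇒≤ {f = rank} λ {i} {j} eq →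
      f-injective (#below-injective (Pf i) (Pf j)
        (trans (sym (Fin.toℕ-fromℕ< (rank< i))) (trans (cong toℕ eq) (Fin.toℕ-fromℕ< (rank< j)))))
    where
    rank< : ∀ j → #below (f j) < #below v
    rank< j = #below-strict (Pf j) (f<v j)
    rank : Fin k → Fin (#below v)
    rank j = fromℕ< (rank< j)

open Counting using (#below; IsKth-#below)

#below-cong : ∀ {P Q : ℕ → Set} (P? : Decidable P) (Q? : Decidable Q) {v} →
              (∀ x → x < v → P x → Q x) → (∀ x → x < v → Q x → P x) → #below P? v ≡ #below Q? v
#below-cong P? Q? {zero}  _   _   = refl
#below-cong P? Q? {suc v} P⇒Q Q⇒P with P? v
... | yes Pv = trans (Counting.#below-suc-yes P? Pv)
                 (trans (cong suc (#below-cong P? Q? (λ x → P⇒Q x ∘ m<n⇒m<1+n) (λ x → Q⇒P x ∘ m<n⇒m<1+n)))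
                   (sym (Counting.#below-suc-yes Q? (P⇒Q v ≤-refl Pv))))
... | no ¬Pv = trans (Counting.#below-suc-no P? ¬Pv)
                 (trans (#below-cong P? Q? (λ x → P⇒Q x ∘ m<n⇒m<1+n) (λ x → Q⇒P x ∘ m<n⇒m<1+n))
                   (sym (Counting.#below-suc-no Q? (¬Pv ∘ Q⇒P v ≤-refl))))

IsKth-cong : ∀ {P Q : ℕ → Set} {k v} → (∀ x → x ≤ v → P x → Q x) → (∀ x → x ≤ v → Q x → P x) →
             IsKth P k v → IsKth Q k v
IsKth-cong {v = v} P⇒Q Q⇒P (Pv , xs , linked , length≡ , xs⇔) = P⇒Q v ≤-refl Pv , xs , linked , length≡ , λ x → mk⇔
  (λ x∈ → let (Px , x<v) = Equivalence.to (xs⇔ x) x∈ in P⇒Q x (<⇒≤ x<v) Px , x<v)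
  (λ (Qx , x<v) → Equivalence.from (xs⇔ x) (Q⇒P x (<⇒≤ x<v) Qx , x<v))

window : (ℕ → ℕ) → ℕ → (N : ℕ) → Vec ℕ N
window m k N = Vec.tabulate (λ i → m (k + toℕ i))

window-∷ : ∀ m k N → window m k (suc N) ≡ m k ∷ window m (suc k) N
window-∷ m k N = cong₂ _∷_ (cong m (+-identityʳ k)) (Vec.tabulate-cong (λ i → cong m (+-suc k (toℕ i))))

window-∷ʳ : ∀ m k N → window m k (suc N) ≡ window m k N ∷ʳ m (k + N)
window-∷ʳ m k zero    = refl
window-∷ʳ m k (suc N) = begin
  window m k (suc (suc N))                     ≡⟨ window-∷ m k (suc N) ⟩
  m k ∷ window m (suc k) (suc N)               ≡⟨ cong (m k ∷_) (window-∷ʳ m (suc k) N) ⟩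
  m k ∷ (window m (suc k) N ∷ʳ m (suc k + N))  ≡⟨ cong (λ i → m k ∷ (window m (suc k) N ∷ʳ m i)) (sym (+-suc k N)) ⟩
  m k ∷ (window m (suc k) N ∷ʳ m (k + suc N))  ≡⟨ cong (_∷ʳ m (k + suc N)) (sym (window-∷ m k N)) ⟩
  window m k (suc N) ∷ʳ m (k + suc N)          ∎
  where open ≡-Reasoning

prefix-∷ʳ : ∀ m N → prefix (suc N) m ≡ prefix N m ∷ʳ m N
prefix-∷ʳ m N = window-∷ʳ m 0 N

last-prefix : ∀ (m : ℕ → ℕ) N → last (prefix (suc N) m) ≡ m N
last-prefix m N = trans (cong last (prefix-∷ʳ m N)) (Vec.last-∷ʳ (m N) (prefix N m))

positions : ℕ → ∀ {N} → Subset N → List ℕ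
positions k []          = List.[]
positions k (true ∷ s)  = k List.∷ positions (suc k) s
positions k (false ∷ s) = positions (suc k) s

sum-positions : ∀ m k {N} (s : Subset N) → sum (map m (positions k s)) ≡ subsetSum s (window m k N)
sum-positions m k []                = refl
sum-positions m k {suc N} (true ∷ s)  =
  trans (cong (m k +_) (sum-positions m (suc k) s)) (cong (subsetSum (true ∷ s)) (sym (window-∷ m k N)))
sum-positions m k {suc N} (false ∷ s) =
  trans (sum-positions m (suc k) s) (cong (subsetSum (false ∷ s)) (sym (window-∷ m k N)))

positions-≥ : ∀ k {N} (s : Subset N) → All (k ≤_) (positions k s)
positions-≥ k []          = All.[]
positions-≥ k (true ∷ s)  = ≤-refl All.∷ All.map (≤-trans (n≤1+n k)) (positions-≥ (suc k) s)
positions-≥ k (false ∷ s) = All.map (≤-trans (n≤1+n k)) (positions-≥ (suc k) s)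

Linked-∷ : ∀ {x xs} → All (x <_) xs → Linked _<_ xs → Linked _<_ (x List.∷ xs)
Linked-∷ All.[]          _      = Linked.[-]
Linked-∷ (x<y All.∷ _)   linked = x<y Linked.∷ linked

Linked-head : ∀ {x xs} → Linked _<_ (x List.∷ xs) → All (x <_) xs
Linked-head linked with Linked.Linked⇒AllPairs <-trans linked
... | x<xs AllPairs.∷ _ = x<xs

positions-Linked : ∀ k {N} (s : Subset N) → Linked _<_ (positions k s)
positions-Linked k []          = Linked.[]
positions-Linked k (true ∷ s)  = Linked-∷ (positions-≥ (suc k) s) (positions-Linked (suc k) s)
positions-Linked k (false ∷ s) = positions-Linked (suc k) s

¬All-<-∷-self : ∀ {k xs} → ¬ All (k <_) (k List.∷ xs)
¬All-<-∷-self (k<k All.∷ _) = <-irrefl refl k<k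

positions-injective : ∀ k {N} (s s′ : Subset N) → positions k s ≡ positions k s′ → s ≡ s′
positions-injective k []          []           eq = refl
positions-injective k (true ∷ s)  (true ∷ s′)  eq =
  cong (true ∷_) (positions-injective (suc k) s s′ (List.∷-injectiveʳ eq))
positions-injective k (false ∷ s) (false ∷ s′) eq = cong (false ∷_) (positions-injective (suc k) s s′ eq)
positions-injective k (true ∷ s)  (false ∷ s′) eq =
  contradiction (subst (All (k <_)) (sym eq) (positions-≥ (suc k) s′)) ¬All-<-∷-self
positions-injective k (false ∷ s) (true ∷ s′)  eq =
  contradiction (subst (All (k <_)) eq (positions-≥ (suc k) s)) ¬All-<-∷-self

<-+-suc : ∀ {i} k N → i < k + suc N → i < suc k + N
<-+-suc {i} k N = subst (i <_) (+-suc k N)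

positions-surjective : ∀ k N (is : List ℕ) → Linked _<_ is → All (λ j → k ≤ j × j < k + N) is →
                       Σ (Subset N) λ s → positions k s ≡ is
positions-surjective k zero    List.[]        _      _ = [] , refl
positions-surjective k zero    (j List.∷ is)  _      ((k≤j , j<k+0) All.∷ _) =
  contradiction (subst (j <_) (+-identityʳ k) j<k+0) (≤⇒≯ k≤j)
positions-surjective k (suc N) List.[]        _      _ =
  let (s , eq) = positions-surjective (suc k) N List.[] Linked.[] All.[] in false ∷ s , eq
positions-surjective k (suc N) (j List.∷ is) linked ((k≤j , j<k+1+N) All.∷ is∈) with j ≟ k
... | yes refl = let (s , eq) = positions-surjective (suc j) N is (Linked.tail linked) is∈′ in true ∷ s , cong (j List.∷_) eq
  where
  is∈′ : All (λ i → suc j ≤ i × i < suc j + N) is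
  is∈′ = All.zipWith (λ (j<i , (_ , i<j+1+N)) → j<i , <-+-suc j N i<j+1+N) (Linked-head linked , is∈)
... | no j≢k = let (s , eq) = positions-surjective (suc k) N (j List.∷ is) linked js∈′ in false ∷ s , eq
  where
  k<j : k < j
  k<j = ≤∧≢⇒< k≤j (j≢k ∘ sym)
  js∈′ : All (λ i → suc k ≤ i × i < suc k + N) (j List.∷ is)
  js∈′ = (k<j , <-+-suc k N j<k+1+N) All.∷
         All.zipWith (λ (j<i , (_ , i<k+1+N)) → <-trans k<j j<i , <-+-suc k N i<k+1+N) (Linked-head linked , is∈)

module Increasing (m : ℕ → ℕ) (m-increasing : ∀ i → m i < m (suc i)) where

  m-mono : ∀ {i j} → i ≤ j → m i ≤ m j
  m-mono {j = zero}  z≤n = ≤-refl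
  m-mono {j = suc j} i≤1+j with m≤n⇒m<n∨m≡n i≤1+j
  ... | inj₁ i<1+j = ≤-trans (m-mono (≤-pred i<1+j)) (<⇒≤ (m-increasing j))
  ... | inj₂ refl  = ≤-refl

  m-cancel-< : ∀ {i j} → m i < m j → i < j
  m-cancel-< {i} {j} mi<mj = ≰⇒> (λ j≤i → <⇒≱ mi<mj (m-mono j≤i))

  terms≤sum : ∀ is → All (λ j → m j ≤ sum (map m is)) is
  terms≤sum List.[]        = All.[]
  terms≤sum (j List.∷ is) = m≤m+n (m j) _ All.∷ All.map (λ mi≤ → ≤-trans mi≤ (m≤n+m _ (m j))) (terms≤sum is)

  positions-of : ∀ N {x is} → Linked _<_ is → sum (map m is) ≡ x → x < m N → Σ (Subset N) λ s → positions 0 s ≡ is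
  positions-of N {is = is} linked sum≡x x<mN = positions-surjective 0 N is linked
    (All.map (λ mj≤sum → z≤n , m-cancel-< (≤-<-trans (subst (_ ≤_) sum≡x mj≤sum) x<mN)) (terms≤sum is))

  subsetSum-prefix : ∀ {N} (s : Subset N) {is x} → positions 0 s ≡ is → sum (map m is) ≡ x →
                     subsetSum s (prefix N m) ≡ x
  subsetSum-prefix s refl = trans (sym (sum-positions m 0 s))

  InRInf⇒InR : ∀ N {x} → x < m N → InRInf m x → InR (prefix N m) x
  InRInf⇒InR N x<mN (is , linked , sum≡x) =
    let (s , s↦is) = positions-of N linked sum≡x x<mN in s , subsetSum-prefix s s↦is sum≡x

  InURInf⇒InUR : ∀ N {x} → x < m N → InURInf m x → InUR (prefix N m) x
  InURInf⇒InUR N {x} x<mN (is , linked , sum≡x , unique) = s , subsetSum-prefix s s↦is sum≡x ,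
    λ s′ s′≡x → positions-injective 0 s′ s
      (trans (unique (positions 0 s′) (positions-Linked 0 s′) (trans (sum-positions m 0 s′) s′≡x)) (sym s↦is))
    where
    s : Subset N
    s = proj₁ (positions-of N linked sum≡x x<mN)
    s↦is : positions 0 s ≡ is
    s↦is = proj₂ (positions-of N linked sum≡x x<mN)

  InUR⇒InURInf : ∀ N {x} → x < m N → InUR (prefix N m) x → InURInf m x
  InUR⇒InURInf N {x} x<mN (s , s≡x , unique) =
    positions 0 s , positions-Linked 0 s , trans (sum-positions m 0 s) s≡x , unique′
    where
    unique′ : ∀ js → Linked _<_ js → sum (map m js) ≡ x → js ≡ positions 0 s
    unique′ js linked js≡x =
      let (s′ , s′↦js) = positions-of N linked js≡x x<mN
      in trans (sym s′↦js) (cong (positions 0) (unique s′ (subsetSum-prefix s′ s′↦js js≡x)))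

  IsKth-InURInf : ∀ N {k v} → v < m N → IsKth (InUR (prefix N m)) k v → IsKth (InURInf m) k v
  IsKth-InURInf N v<mN = IsKth-cong (λ x x≤v → InUR⇒InURInf N (≤-<-trans x≤v v<mN))
                                    (λ x x≤v → InURInf⇒InUR N (≤-<-trans x≤v v<mN))

TournamentSteps : ∀ {n} → Vec ℕ (suc n) → Set
TournamentSteps {n} t = ∀ (i : Fin n) → lookup t (inject₁ i) < lookup t (Fin.suc i)
                                      × lookup t (Fin.suc i) ≤ 2 * lookup t (inject₁ i)

TournamentSteps-∷ʳ : ∀ {n} (t : Vec ℕ (suc n)) {x} → TournamentSteps t → last t < x → x ≤ 2 * last t →
                     TournamentSteps (t ∷ʳ x)
TournamentSteps-∷ʳ (a ∷ [])     steps a<x x≤2a Fin.zero    = a<x , x≤2a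
TournamentSteps-∷ʳ (a ∷ b ∷ t)  steps a<x x≤2a Fin.zero    = steps Fin.zero
TournamentSteps-∷ʳ (a ∷ b ∷ t)  steps a<x x≤2a (Fin.suc i) = TournamentSteps-∷ʳ (b ∷ t) (steps ∘ Fin.suc) a<x x≤2a i

TournamentSteps-∷ʳ⁻ : ∀ {n} (t : Vec ℕ (suc n)) {x} → TournamentSteps (t ∷ʳ x) →
                      TournamentSteps t × last t < x × x ≤ 2 * last t
TournamentSteps-∷ʳ⁻ (a ∷ [])    steps = (λ ()) , steps Fin.zero
TournamentSteps-∷ʳ⁻ (a ∷ b ∷ t) steps =
  let (steps′ , b<x , x≤2b) = TournamentSteps-∷ʳ⁻ (b ∷ t) (steps ∘ Fin.suc)
  in (λ { Fin.zero → steps Fin.zero ; (Fin.suc i) → steps′ i }) , b<x , x≤2b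

head-∷ʳ : ∀ {n} (t : Vec ℕ (suc n)) x → head (t ∷ʳ x) ≡ head t
head-∷ʳ (a ∷ t) x = refl

IsTournament-∷ʳ : ∀ {n} (t : Vec ℕ (suc n)) {x} → IsTournament t → last t < x → x ≤ 2 * last t →
                  IsTournament (t ∷ʳ x)
IsTournament-∷ʳ t {x} (t₀≡1 , steps) a<x x≤2a = trans (head-∷ʳ t x) t₀≡1 , TournamentSteps-∷ʳ t steps a<x x≤2a

IsTournament-∷ʳ⁻ : ∀ {n} (t : Vec ℕ (suc n)) {x} → IsTournament (t ∷ʳ x) →
                   IsTournament t × last t < x × x ≤ 2 * last t
IsTournament-∷ʳ⁻ t {x} (t₀≡1 , steps) =
  let (steps′ , a<x , x≤2a) = TournamentSteps-∷ʳ⁻ t steps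
  in (trans (sym (head-∷ʳ t x)) t₀≡1 , steps′) , a<x , x≤2a

lookup-prefix : ∀ N (g : ℕ → ℕ) (i : Fin N) → lookup (prefix N g) i ≡ g (toℕ i)
lookup-prefix N g = Vec.lookup∘tabulate (g ∘ toℕ)

prefix-IsTournament : ∀ {T} → IsTournamentInf T → ∀ k → IsTournament (prefix (suc k) T)
prefix-IsTournament {T} (T₀≡1 , steps) k = T₀≡1 , λ i →
  subst₂ (λ a b → a < b × b ≤ 2 * a)
    (sym (trans (lookup-prefix (suc k) T (inject₁ i)) (cong T (Fin.toℕ-inject₁ i))))
    (sym (lookup-prefix (suc k) T (Fin.suc i)))
    (steps (toℕ i))

n∸1<n : ∀ {n} → 0 < n → n ∸ 1 < n
n∸1<n {suc n} _ = ≤-refl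

suc[n∸1]≡n : ∀ {n} → 0 < n → suc (n ∸ 1) ≡ n
suc[n∸1]≡n {suc n} _ = refl

record MeeussenStep {n} (v : Vec ℕ (suc n)) (y : ℕ) : Set where
  field
    pred-unique : InUR v (y ∸ 1)
    ≤sum+1      : y ≤ suc (Vec.sum v)
    last<       : last v < y

IsMeeussenInf⇒MeeussenStep : ∀ m → IsMeeussenInf m → ∀ n → MeeussenStep (prefix (suc n) m) (m (suc n))
IsMeeussenInf⇒MeeussenStep m (_ , m-increasing , complete , pred-unique) n = record
  { pred-unique = InURInf⇒InUR N (n∸1<n 0<mN) (pred-unique N)
  ; ≤sum+1      = ≮⇒≥ beyond-sum
  ; last<       = subst (_< m N) (sym (last-prefix m n)) (m-increasing n)
  }
  where
  open Increasing m m-increasing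
  N : ℕ
  N = suc n
  0<mN : 0 < m N
  0<mN = ≤-<-trans z≤n (m-increasing n)
  beyond-sum : ¬ suc (Vec.sum (prefix N m)) < m N
  beyond-sum sum<mN = let (s , s≡) = InRInf⇒InR N sum<mN (complete _)
                      in 1+n≰n (subst (_≤ _) s≡ (subsetSum≤sum s (prefix N m)))

IsMeeussen-∷ʳ⇒MeeussenStep : ∀ {n} (v : Vec ℕ (suc n)) y → IsMeeussen (v ∷ʳ y) → MeeussenStep v y
IsMeeussen-∷ʳ⇒MeeussenStep {n} v y (m , meeussen , v∷ʳy≡m) =
  subst₂ MeeussenStep (sym (Vec.∷ʳ-injectiveˡ v (prefix (suc n) m) v∷ʳy≡prefix))
                      (sym (Vec.∷ʳ-injectiveʳ v (prefix (suc n) m) v∷ʳy≡prefix))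
    (IsMeeussenInf⇒MeeussenStep m meeussen n)
  where
  v∷ʳy≡prefix : v ∷ʳ y ≡ prefix (suc n) m ∷ʳ m (suc n)
  v∷ʳy≡prefix = trans (sym (Vec.tabulate∘lookup (v ∷ʳ y))) (trans (Vec.tabulate-cong v∷ʳy≡m) (prefix-∷ʳ m (suc n)))

sumFirst-∷ʳ : ∀ {n} k (v : Vec ℕ n) a → k ≤ n → sumFirst k (v ∷ʳ a) ≡ sumFirst k v
sumFirst-∷ʳ zero    v       a _         = refl
sumFirst-∷ʳ (suc k) (x ∷ v) a (s≤s k≤n) = cong (x +_) (sumFirst-∷ʳ k v a k≤n)

sumFirst-∷ʳ-all : ∀ {n} (v : Vec ℕ n) a → sumFirst n (v ∷ʳ a) ≡ Vec.sum v
sumFirst-∷ʳ-all []      a = refl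
sumFirst-∷ʳ-all (x ∷ v) a = cong (x +_) (sumFirst-∷ʳ-all v a)

sumFirst+last : ∀ {n} (v : Vec ℕ (suc n)) → sumFirst n v + last v ≡ Vec.sum v
sumFirst+last (x ∷ [])    = sym (+-identityʳ x)
sumFirst+last (x ∷ y ∷ v) = trans (+-assoc x _ _) (cong (x +_) (sumFirst+last (y ∷ v)))

sumFirst-mono : ∀ {n} {j k} (v : Vec ℕ n) → j ≤ k → sumFirst j v ≤ sumFirst k v
sumFirst-mono {j = zero}              v       _         = z≤n
sumFirst-mono {j = suc j} {suc k}     []      _         = ≤-refl
sumFirst-mono {j = suc j} {suc k}     (x ∷ v) (s≤s j≤k) = +-monoʳ-≤ x (sumFirst-mono v j≤k)

sumFirst-prefix : ∀ (g : ℕ → ℕ) i → sumFirst i (prefix (suc i) g) ≡ sum (map g (upTo i))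
sumFirst-prefix g i = trans (applyUpTo-sum g i) (cong sum (sym (List.map-upTo g i)))
  where
  applyUpTo-sum : ∀ (g : ℕ → ℕ) i → sumFirst i (prefix (suc i) g) ≡ sum (List.applyUpTo g i)
  applyUpTo-sum g zero    = refl
  applyUpTo-sum g (suc i) = cong (g 0 +_) (applyUpTo-sum (g ∘ suc) i)

-- If g x exceeded x, then (induction on N ∸ x) g would fix g x, so injectivity would give g x ≡ x.
inflationary-injective⇒id : ∀ lo N (g : ℕ → ℕ) →
  (∀ {x} → lo < x → x ≤ N → x ≤ g x) → (∀ {x} → lo < x → x ≤ N → g x ≤ N) →
  (∀ {x x′} → lo < x → x ≤ N → lo < x′ → x′ ≤ N → g x ≡ g x′ → x ≡ x′) →
  ∀ {x} → lo < x → x ≤ N → g x ≡ x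
inflationary-injective⇒id lo N g inflationary bounded injective {x} lo<x x≤N = fix N lo<x x≤N (m≤m+n N x)
  where
  fix : ∀ d {x} → lo < x → x ≤ N → N ≤ d + x → g x ≡ x
  fix zero    lo<x x≤N N≤x = ≤-antisym (≤-trans (bounded lo<x x≤N) N≤x) (inflationary lo<x x≤N)
  fix (suc d) {x} lo<x x≤N N≤d+1+x with m≤n⇒m<n∨m≡n (inflationary lo<x x≤N)
  ... | inj₂ x≡gx = sym x≡gx
  ... | inj₁ x<gx = injective lo<gx (bounded lo<x x≤N) lo<x x≤N
                      (fix d lo<gx (bounded lo<x x≤N) N≤d+gx)
    where
    lo<gx : lo < g x
    lo<gx = <-trans lo<x x<gx
    N≤d+gx : N ≤ d + g x
    N≤d+gx = ≤-trans N≤d+1+x (subst (_≤ d + g x) (+-suc d x) (+-monoʳ-≤ d x<gx))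

lookup-∷ʳ-inject₁ : ∀ {A : Set} {n} (v : Vec A n) a (j : Fin n) → lookup (v ∷ʳ a) (inject₁ j) ≡ lookup v j
lookup-∷ʳ-inject₁ (x ∷ v) a Fin.zero    = refl
lookup-∷ʳ-inject₁ (x ∷ v) a (Fin.suc j) = lookup-∷ʳ-inject₁ v a j

lookup-fromℕ : ∀ {A : Set} {n} (v : Vec A (suc n)) → lookup v (fromℕ n) ≡ last v
lookup-fromℕ (x ∷ [])    = refl
lookup-fromℕ (x ∷ y ∷ v) = lookup-fromℕ (y ∷ v)

inject₁-or-fromℕ : ∀ {n} (P : Fin (suc n) → Set) → (∀ j → P (inject₁ j)) → P (fromℕ n) → ∀ i → P i
inject₁-or-fromℕ {zero}  P inj fro Fin.zero    = fro
inject₁-or-fromℕ {suc n} P inj fro Fin.zero    = inj Fin.zero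
inject₁-or-fromℕ {suc n} P inj fro (Fin.suc i) = inject₁-or-fromℕ (P ∘ Fin.suc) (inj ∘ Fin.suc) fro i

-- The invariant along a branch of the tournament tree

#ur : ∀ {n} → Vec ℕ n → ℕ → ℕ
#ur v = #below (InUR? v)

#ur-pred : ∀ {n} (v : Vec ℕ n) {y} → 0 < y → InUR v (y ∸ 1) → #ur v y ≡ suc (#ur v (y ∸ 1))
#ur-pred v 0<y y∸1∈ur = trans (cong (#ur v) (sym (suc[n∸1]≡n 0<y))) (Counting.#below-suc-yes (InUR? v) y∸1∈ur)

#ur-∷ʳ : ∀ {n} (v : Vec ℕ n) a → #ur (v ∷ʳ a) a ≡ #ur v a
#ur-∷ʳ v a = #below-cong (InUR? (v ∷ʳ a)) (InUR? v) (λ x x<a → InUR-∷ʳ⁻ v x<a) (λ x x<a → InUR-∷ʳ⁺ v x<a)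

IsKth-InUR-∷ʳ : ∀ {n} (v : Vec ℕ n) {a k x} → x < a → IsKth (InUR v) k x → IsKth (InUR (v ∷ʳ a)) k x
IsKth-InUR-∷ʳ v x<a = IsKth-cong (λ z z≤x → InUR-∷ʳ⁺ v (≤-<-trans z≤x x<a))
                                 (λ z z≤x → InUR-∷ʳ⁻ v (≤-<-trans z≤x x<a))

sum∸pred-last : ∀ {n} (M : Vec ℕ (suc n)) → 0 < last M → Vec.sum M ∸ (last M ∸ 1) ≡ sumFirst n M + 1
sum∸pred-last {n} M 0<m = begin
  Vec.sum M ∸ (m ∸ 1)                    ≡⟨ cong (_∸ (m ∸ 1)) (sym (sumFirst+last M)) ⟩
  (Sp + m) ∸ (m ∸ 1)                     ≡⟨ cong (λ w → (Sp + w) ∸ (m ∸ 1)) (sym (suc[n∸1]≡n 0<m)) ⟩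
  (Sp + suc (m ∸ 1)) ∸ (m ∸ 1)           ≡⟨ cong (_∸ (m ∸ 1)) (sym (+-assoc Sp 1 (m ∸ 1))) ⟩
  (Sp + 1 + (m ∸ 1)) ∸ (m ∸ 1)           ≡⟨ m+n∸n≡m (Sp + 1) (m ∸ 1) ⟩
  Sp + 1                                 ∎
  where
  open ≡-Reasoning
  m Sp : ℕ
  m = last M
  Sp = sumFirst n M

Claim : ∀ {n} (t M : Vec ℕ (suc n)) → Fin (suc n) → Set
Claim t M i = IsKth (InUR M) (lookup t i) (lookup M i ∸ 1) × IsKth (InUR M) (suc (lookup t i)) (sumFirst (toℕ i) M + 1)

record Invariant {n} (t M : Vec ℕ (suc n)) : Set where
  field
    complete         : Complete M
    gap              : ∀ {z} → InUR M z → last M ≤ z → z ≤ sumFirst n M → ⊥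
    last≤            : last M ≤ suc (sumFirst n M)
    ≤last            : ∀ j → lookup M j ≤ last M
    0<last           : 0 < last M
    pred-last-unique : InUR M (last M ∸ 1)
    #ur-last         : #ur M (last M) ≡ last t

module _ {n} {t M : Vec ℕ (suc n)} (I : Invariant t M) where
  open Invariant I

  #ur-last≡#ur-sumFirst : #ur M (suc (sumFirst n M)) ≡ #ur M (last M)
  #ur-last≡#ur-sumFirst = Counting.#below-gap (InUR? M) last≤ (λ z m≤z z<1+Sp z∈ur → gap z∈ur m≤z (≤-pred z<1+Sp))

  -- The unique sums are symmetric under z ↦ sum M ∸ z and avoid [last M, sumFirst n M].
  #ur-sum : #ur M (suc (Vec.sum M)) ≡ last t + last t
  #ur-sum = begin
    #ur M (suc (Vec.sum M))                                ≡⟨ Counting.#below-reflect (InUR? M) (Vec.sum M)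
                                                                (λ z _ → InUR-reflect M z) (last M) m≤1+S ⟩
    #ur M (suc (Vec.sum M) ∸ last M) + #ur M (last M)      ≡⟨ cong (λ w → #ur M w + #ur M (last M)) 1+S∸m≡1+Sp ⟩
    #ur M (suc (sumFirst n M)) + #ur M (last M)            ≡⟨ cong (_+ #ur M (last M)) #ur-last≡#ur-sumFirst ⟩
    #ur M (last M) + #ur M (last M)                        ≡⟨ cong₂ _+_ #ur-last #ur-last ⟩
    last t + last t                                        ∎
    where
    open ≡-Reasoning
    m≤1+S : last M ≤ suc (Vec.sum M)
    m≤1+S = ≤-trans (m≤n+m (last M) _) (≤-trans (≤-reflexive (sumFirst+last M)) (n≤1+n _))
    1+S∸m≡1+Sp : suc (Vec.sum M) ∸ last M ≡ suc (sumFirst n M)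
    1+S∸m≡1+Sp = trans (cong (λ w → suc w ∸ last M) (sym (sumFirst+last M))) (m+n∸n≡m (suc (sumFirst n M)) (last M))

  Claim-last : Claim t M (fromℕ n)
  Claim-last rewrite lookup-fromℕ t | lookup-fromℕ M | Fin.toℕ-fromℕ n =
    subst (λ k → IsKth (InUR M) k (last M ∸ 1)) #ur-pred-last (IsKth-#below (InUR? M) pred-last-unique) ,
    subst (λ k → IsKth (InUR M) (suc k) (sumFirst n M + 1)) #ur-sumFirst+1 (IsKth-#below (InUR? M) sumFirst+1-unique)
    where
    #ur-pred-last : suc (#ur M (last M ∸ 1)) ≡ last t
    #ur-pred-last = trans (sym (#ur-pred M 0<last pred-last-unique)) #ur-last
    sumFirst+1-unique : InUR M (sumFirst n M + 1)
    sumFirst+1-unique = subst (InUR M) (sum∸pred-last M 0<last) (InUR-reflect M _ pred-last-unique)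
    #ur-sumFirst+1 : #ur M (sumFirst n M + 1) ≡ last t
    #ur-sumFirst+1 = trans (cong (#ur M) (+-comm (sumFirst n M) 1)) (trans #ur-last≡#ur-sumFirst #ur-last)

  sumFirst+2≤ : ∀ {y} → MeeussenStep M y → suc (suc (sumFirst n M)) ≤ y
  sumFirst+2≤ {y} step = subst (suc (suc (sumFirst n M)) ≤_) (suc[n∸1]≡n 0<y) (s≤s (≰⇒> pred-outside-gap))
    where
    open MeeussenStep step
    0<y : 0 < y
    0<y = ≤-<-trans z≤n last<
    pred-outside-gap : ¬ y ∸ 1 ≤ sumFirst n M
    pred-outside-gap = gap pred-unique (≤-pred (subst (last M <_) (sym (suc[n∸1]≡n 0<y)) last<))

  Claim-∷ʳ : ∀ {x y} → MeeussenStep M y → ∀ j → Claim t M j → Claim (t ∷ʳ x) (M ∷ʳ y) (inject₁ j)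
  Claim-∷ʳ {x} {y} step j (kth-pred , kth-sum)
    rewrite lookup-∷ʳ-inject₁ t x j | lookup-∷ʳ-inject₁ M y j | Fin.toℕ-inject₁ j
          | sumFirst-∷ʳ (toℕ j) M y (<⇒≤ (Fin.toℕ<n j)) =
    IsKth-InUR-∷ʳ M (≤-<-trans (m∸n≤m _ 1) (≤-<-trans (≤last j) (MeeussenStep.last< step))) kth-pred ,
    IsKth-InUR-∷ʳ M sum+1<y kth-sum
    where
    sum+1<y : sumFirst (toℕ j) M + 1 < y
    sum+1<y = ≤-trans (s≤s (≤-trans (≤-reflexive (+-comm _ 1)) (s≤s (sumFirst-mono M (≤-pred (Fin.toℕ<n j))))))
                      (sumFirst+2≤ step)

  Invariant-∷ʳ : ∀ {x y} → MeeussenStep M y → #ur M y ≡ x → Invariant (t ∷ʳ x) (M ∷ʳ y)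
  Invariant-∷ʳ {x} {y} step #ur-y = record
    { complete         = Complete-∷ʳ M complete ≤sum+1
    ; gap              = λ z∈ur y≤z z≤S →
                           InUR-∷ʳ-gap M complete z∈ur (subst (_≤ _) last≡y y≤z) (subst (_ ≤_) (sumFirst-∷ʳ-all M y) z≤S)
    ; last≤            = subst₂ (λ u v → u ≤ suc v) (sym last≡y) (sym (sumFirst-∷ʳ-all M y)) ≤sum+1
    ; ≤last            = inject₁-or-fromℕ (λ j → lookup (M ∷ʳ y) j ≤ last (M ∷ʳ y))
                           (λ j → subst₂ _≤_ (sym (lookup-∷ʳ-inject₁ M y j)) (sym last≡y)
                                             (≤-trans (≤last j) (<⇒≤ last<)))
                           (≤-reflexive (lookup-fromℕ (M ∷ʳ y)))
    ; 0<last           = subst (0 <_) (sym last≡y) (≤-<-trans z≤n last<)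
    ; pred-last-unique = subst (λ u → InUR (M ∷ʳ y) (u ∸ 1)) (sym last≡y)
                               (InUR-∷ʳ⁺ M (n∸1<n (≤-<-trans z≤n last<)) pred-unique)
    ; #ur-last         = trans (cong (#ur (M ∷ʳ y)) last≡y) (trans (#ur-∷ʳ M y) (trans #ur-y (sym (Vec.last-∷ʳ x t))))
    }
    where
    open MeeussenStep step
    last≡y : last (M ∷ʳ y) ≡ y
    last≡y = Vec.last-∷ʳ y M

Invariant-root : Invariant (1 ∷ []) (1 ∷ [])
Invariant-root = record
  { complete         = λ { zero _ → (false ∷ []) , refl ; (suc zero) _ → (true ∷ []) , refl ; (suc (suc x)) (s≤s ()) }
  ; gap              = λ { _ (s≤s _) () }
  ; last≤            = ≤-refl
  ; ≤last            = λ { Fin.zero → ≤-refl }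
  ; 0<last           = s≤s z≤n
  ; pred-last-unique = 0-unique
  ; #ur-last         = Counting.#below-suc-yes (InUR? (1 ∷ [])) 0-unique
  }
  where
  0-unique : InUR (1 ∷ []) 0
  0-unique = (false ∷ []) , refl , λ { (false ∷ []) _ → refl ; (true ∷ []) () }

-- The tree isomorphism

module TreeIsomorphism (φ : Seqmap) (iso : IsTreeIso φ) where
  open IsTreeIso iso

  next : ∀ {n} → Vec ℕ (suc n) → ℕ → ℕ
  next t x = last (φ (t ∷ʳ x))

  φ-∷ʳ : ∀ {n} (t : Vec ℕ (suc n)) {x} → IsTournament (t ∷ʳ x) → φ (t ∷ʳ x) ≡ φ t ∷ʳ next t x
  φ-∷ʳ t {x} tx-tournament = trans (proj₂ (proj₂ (Vec.initLast (φ (t ∷ʳ x)))))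
    (cong (_∷ʳ next t x) (trans (sym (parent (t ∷ʳ x) tx-tournament)) (cong φ (Vec.init-∷ʳ x t))))

  next-MeeussenStep : ∀ {n} (t : Vec ℕ (suc n)) {x} → IsTournament (t ∷ʳ x) → MeeussenStep (φ t) (next t x)
  next-MeeussenStep t {x} tx-tournament =
    IsMeeussen-∷ʳ⇒MeeussenStep (φ t) (next t x) (subst IsMeeussen (φ-∷ʳ t tx-tournament) (maps (t ∷ʳ x) tx-tournament))

  next-injective : ∀ {n} (t : Vec ℕ (suc n)) {x x′} → IsTournament (t ∷ʳ x) → IsTournament (t ∷ʳ x′) →
                   next t x ≡ next t x′ → x ≡ x′
  next-injective t {x} {x′} tx-tournament tx′-tournament eq = Vec.∷ʳ-injectiveʳ t t
    (inj (t ∷ʳ x) (t ∷ʳ x′) tx-tournament tx′-tournament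
      (trans (φ-∷ʳ t tx-tournament) (trans (cong (φ t ∷ʳ_) eq) (sym (φ-∷ʳ t tx′-tournament)))))

  -- Each of the x children z of c yields the unique sum sum ∸ (next c z ∸ 1) ≤ sum ∸ last, the mirror image
  -- of next c z ∸ 1; these are distinct because next c is injective.
  last≤#ur : ∀ {n} (c : Vec ℕ (suc n)) → IsTournament c → last c ≤ #ur (φ c) (suc (Vec.sum (φ c) ∸ last (φ c)))
  last≤#ur {n} c c-tournament = Counting.≤-#below (InUR? M) f f-injective (λ j → InUR-reflect M _ (pred-unique j)) f<1+S∸last
    where
    M : Vec ℕ (suc n)
    M = φ c
    x S : ℕ
    x = last c
    S = Vec.sum M
    child : Fin x → ℕ
    child j = suc (x + toℕ j)
    child≤2x : ∀ j → child j ≤ 2 * x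
    child≤2x j = subst (child j ≤_) (cong (x +_) (sym (+-identityʳ x)))
                   (subst (_≤ x + x) (+-suc x (toℕ j)) (+-monoʳ-≤ x (Fin.toℕ<n j)))
    child-tournament : ∀ j → IsTournament (c ∷ʳ child j)
    child-tournament j = IsTournament-∷ʳ c c-tournament (s≤s (m≤m+n x _)) (child≤2x j)
    w : Fin x → ℕ
    w j = next c (child j)
    open module ChildStep j = MeeussenStep (next-MeeussenStep c (child-tournament j))
    0<w : ∀ j → 0 < w j
    0<w j = ≤-<-trans z≤n (last< j)
    w∸1≤S : ∀ j → w j ∸ 1 ≤ S
    w∸1≤S j = ≤-pred (subst (_≤ suc S) (sym (suc[n∸1]≡n (0<w j))) (≤sum+1 j))
    f : Fin x → ℕ
    f j = S ∸ (w j ∸ 1)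
    f<1+S∸last : ∀ j → f j < suc (S ∸ last M)
    f<1+S∸last j = s≤s (∸-monoʳ-≤ S (≤-pred (subst (last M <_) (sym (suc[n∸1]≡n (0<w j))) (last< j))))
    f-injective : ∀ {i j} → f i ≡ f j → i ≡ j
    f-injective {i} {j} fi≡fj = Fin.toℕ-injective (+-cancelˡ-≡ x _ _ (suc-injective
      (next-injective c (child-tournament i) (child-tournament j)
        (∸-cancelʳ-≡ (0<w i) (0<w j) (∸-cancelˡ-≡ (w∸1≤S i) (w∸1≤S j) fi≡fj)))))

  module _ {n} {t : Vec ℕ (suc n)} (t-tournament : IsTournament t) (I : Invariant t (φ t)) where
    open Invariant I

    a : ℕ
    a = last t
    M : Vec ℕ (suc n)
    M = φ t

    child-tournament : ∀ {x} → a < x → x ≤ 2 * a → IsTournament (t ∷ʳ x)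
    child-tournament = IsTournament-∷ʳ t t-tournament

    #ur-next-inflationary : ∀ {x} → a < x → x ≤ 2 * a → x ≤ #ur M (next t x)
    #ur-next-inflationary {x} a<x x≤2a = begin
      x                                                    ≡⟨ Vec.last-∷ʳ x t ⟨
      last (t ∷ʳ x)                                        ≤⟨ last≤#ur (t ∷ʳ x) tx-tournament ⟩
      #ur (φ (t ∷ʳ x)) (suc (Vec.sum (φ (t ∷ʳ x)) ∸ last (φ (t ∷ʳ x))))
                                                           ≡⟨ cong (λ v → #ur v (suc (Vec.sum v ∸ last v))) (φ-∷ʳ t tx-tournament) ⟩
      #ur (M ∷ʳ y) (suc (Vec.sum (M ∷ʳ y) ∸ last (M ∷ʳ y))) ≡⟨ cong (#ur (M ∷ʳ y)) (cong suc S′∸y≡S) ⟩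
      #ur (M ∷ʳ y) (suc (Vec.sum M))                       ≡⟨ Counting.#below-gap (InUR? (M ∷ʳ y)) ≤sum+1
                                                                (λ z y≤z z<1+S z∈ur →
                                                                  InUR-∷ʳ-gap M complete z∈ur y≤z (≤-pred z<1+S)) ⟩
      #ur (M ∷ʳ y) y                                       ≡⟨ #ur-∷ʳ M y ⟩
      #ur M y                                              ∎
      where
      open ≤-Reasoning
      tx-tournament : IsTournament (t ∷ʳ x)
      tx-tournament = child-tournament a<x x≤2a
      y : ℕ
      y = next t x
      open MeeussenStep (next-MeeussenStep t tx-tournament)
      S′∸y≡S : Vec.sum (M ∷ʳ y) ∸ last (M ∷ʳ y) ≡ Vec.sum M
      S′∸y≡S = trans (cong₂ _∸_ (sum-∷ʳ M y) (Vec.last-∷ʳ y M)) (m+n∸n≡m (Vec.sum M) y)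

    #ur-next-bounded : ∀ {x} → a < x → x ≤ 2 * a → #ur M (next t x) ≤ 2 * a
    #ur-next-bounded a<x x≤2a =
      ≤-trans (Counting.#below-mono (InUR? M) (MeeussenStep.≤sum+1 (next-MeeussenStep t (child-tournament a<x x≤2a))))
              (≤-reflexive (trans (#ur-sum I) (cong (a +_) (sym (+-identityʳ a)))))

    #ur-next-injective : ∀ {x x′} → a < x → x ≤ 2 * a → a < x′ → x′ ≤ 2 * a →
                         #ur M (next t x) ≡ #ur M (next t x′) → x ≡ x′
    #ur-next-injective {x} {x′} a<x x≤2a a<x′ x′≤2a eq = next-injective t tx-tournament tx′-tournament
      (∸-cancelʳ-≡ 0<y 0<y′ (Counting.#below-injective (InUR? M) (pred-unique step) (pred-unique step′) pred-eq))
      where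
      open MeeussenStep
      tx-tournament : IsTournament (t ∷ʳ x)
      tx-tournament = child-tournament a<x x≤2a
      tx′-tournament : IsTournament (t ∷ʳ x′)
      tx′-tournament = child-tournament a<x′ x′≤2a
      step : MeeussenStep M (next t x)
      step = next-MeeussenStep t tx-tournament
      step′ : MeeussenStep M (next t x′)
      step′ = next-MeeussenStep t tx′-tournament
      0<y : 0 < next t x
      0<y = ≤-<-trans z≤n (last< step)
      0<y′ : 0 < next t x′
      0<y′ = ≤-<-trans z≤n (last< step′)
      pred-eq : #ur M (next t x ∸ 1) ≡ #ur M (next t x′ ∸ 1)
      pred-eq = suc-injective (trans (sym (#ur-pred M 0<y (pred-unique step))) (trans eq (#ur-pred M 0<y′ (pred-unique step′))))

    #ur-next : ∀ {x} → a < x → x ≤ 2 * a → #ur M (next t x) ≡ x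
    #ur-next = inflationary-injective⇒id a (2 * a) (#ur M ∘ next t) #ur-next-inflationary #ur-next-bounded #ur-next-injective

  invariant : ∀ n (t : Vec ℕ (suc n)) → IsTournament t → Invariant t (φ t)
  invariant zero    (a ∷ []) (refl , _) = subst (Invariant (1 ∷ [])) (sym root) Invariant-root
  invariant (suc n) t′       t′-tournament with Vec.initLast t′
  ... | t , x , refl = subst (Invariant (t ∷ʳ x)) (sym (φ-∷ʳ t t′-tournament))
    (Invariant-∷ʳ I (next-MeeussenStep t t′-tournament) (#ur-next t-tournament I a<x x≤2a))
    where
    t-tournament : IsTournament t
    t-tournament = proj₁ (IsTournament-∷ʳ⁻ t t′-tournament)
    a<x : last t < x
    a<x = proj₁ (proj₂ (IsTournament-∷ʳ⁻ t t′-tournament))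
    x≤2a : x ≤ 2 * last t
    x≤2a = proj₂ (proj₂ (IsTournament-∷ʳ⁻ t t′-tournament))
    I : Invariant t (φ t)
    I = invariant n t t-tournament

  claim : ∀ n (t : Vec ℕ (suc n)) → IsTournament t → ∀ i → Claim t (φ t) i
  claim zero    t  t-tournament Fin.zero = Claim-last (invariant zero t t-tournament)
  claim (suc n) t′ t′-tournament with Vec.initLast t′
  ... | t , x , refl = inject₁-or-fromℕ (Claim (t ∷ʳ x) (φ (t ∷ʳ x)))
    (λ j → subst (λ v → Claim (t ∷ʳ x) v (inject₁ j)) (sym (φ-∷ʳ t t′-tournament))
             (Claim-∷ʳ (invariant n t t-tournament) (next-MeeussenStep t t′-tournament) j (claim n t t-tournament j)))
    (Claim-last (invariant (suc n) (t ∷ʳ x) t′-tournament))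
    where
    t-tournament : IsTournament t
    t-tournament = proj₁ (IsTournament-∷ʳ⁻ t t′-tournament)

  module Branch (T M : ℕ → ℕ) (T-tournament : IsTournamentInf T)
                (φT≡M : ∀ n → φ (prefix (suc n) T) ≡ prefix (suc n) M) where

    next≡M : ∀ j → next (prefix (suc j) T) (T (suc j)) ≡ M (suc j)
    next≡M j = begin
      last (φ (prefix (suc j) T ∷ʳ T (suc j)))  ≡⟨ cong (last ∘ φ) (prefix-∷ʳ T (suc j)) ⟨
      last (φ (prefix (suc (suc j)) T))         ≡⟨ cong last (φT≡M (suc j)) ⟩
      last (prefix (suc (suc j)) M)             ≡⟨ last-prefix M (suc j) ⟩
      M (suc j)                                 ∎
      where open ≡-Reasoning

    step : ∀ j → MeeussenStep (prefix (suc j) M) (M (suc j))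
    step j = subst₂ MeeussenStep (φT≡M j) (next≡M j) (next-MeeussenStep (prefix (suc j) T)
      (subst IsTournament (prefix-∷ʳ T (suc j)) (prefix-IsTournament T-tournament (suc j))))

    M-increasing : ∀ j → M j < M (suc j)
    M-increasing j = subst (_< M (suc j)) (last-prefix M j) (MeeussenStep.last< (step j))

    prefix-invariant : ∀ i → Invariant (prefix (suc i) T) (prefix (suc i) M)
    prefix-invariant i = subst (Invariant _) (φT≡M i) (invariant i _ (prefix-IsTournament T-tournament i))

    sum+2≤ : ∀ i → suc (suc (sum (map M (upTo i)))) ≤ M (suc i)
    sum+2≤ i = subst (λ s → suc (suc s) ≤ M (suc i)) (sumFirst-prefix M i) (sumFirst+2≤ (prefix-invariant i) (step i))

    claim-prefix : ∀ i → IsKth (InUR (prefix (suc i) M)) (T i) (M i ∸ 1)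
                       × IsKth (InUR (prefix (suc i) M)) (suc (T i)) (sum (map M (upTo i)) + 1)
    claim-prefix i = cast (trans (lookup-prefix (suc i) T (fromℕ i)) (cong T (Fin.toℕ-fromℕ i)))
                          (trans (lookup-prefix (suc i) M (fromℕ i)) (cong M (Fin.toℕ-fromℕ i)))
                          (trans (cong (λ k → sumFirst k (prefix (suc i) M)) (Fin.toℕ-fromℕ i)) (sumFirst-prefix M i))
                          (Claim-last (prefix-invariant i))
      where
      cast : ∀ {t m s} → lookup (prefix (suc i) T) (fromℕ i) ≡ t → lookup (prefix (suc i) M) (fromℕ i) ≡ m →
             sumFirst (toℕ (fromℕ i)) (prefix (suc i) M) ≡ s → Claim (prefix (suc i) T) (prefix (suc i) M) (fromℕ i) →
             IsKth (InUR (prefix (suc i) M)) t (m ∸ 1) × IsKth (InUR (prefix (suc i) M)) (suc t) (s + 1)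
      cast refl refl refl c = c

lemma1 : (φ : Seqmap) → IsTreeIso φ →
    -- finite tournament sequences
    ((n : ℕ) (t : Vec ℕ (suc n)) → IsTournament t → (i : Fin (suc n)) →
      IsKth (InUR (φ t)) (lookup t i) (lookup (φ t) i ∸ 1)
      × IsKth (InUR (φ t)) (suc (lookup t i)) (sumFirst (toℕ i) (φ t) + 1))
    ×
    -- infinite tournament sequences (M = φ(T) taken prefix-wise)
    ((T M : ℕ → ℕ) → IsTournamentInf T →
      (∀ n → φ (prefix (suc n) T) ≡ prefix (suc n) M) → (i : ℕ) →
      IsKth (InURInf M) (T i) (M i ∸ 1)
      × IsKth (InURInf M) (suc (T i)) (sum (map M (upTo i)) + 1))
lemma1 φ iso = claim , λ T M T-tournament φT≡M i →
  let open Branch T M T-tournament φT≡M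
      open Increasing M M-increasing
  in IsKth-InURInf (suc i) (≤-<-trans (m∸n≤m (M i) 1) (M-increasing i)) (proj₁ (claim-prefix i)) ,
     IsKth-InURInf (suc i) (subst (_< M (suc i)) (+-comm 1 _) (sum+2≤ i)) (proj₂ (claim-prefix i))
  where open TreeIsomorphism φ iso
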